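{- For every integer $n \geq 3$, $C_n^{(2)} \in GR(3)$.
   Context: A $k$-colored graph $G=(V,E)$ consists of a finite set $V$ and a function $E$ from the 2-element subsets of $V$ to $\{0,\ldots,k-1\}$. An automorphism of $G$ is a permutation of $V$ preserving $E$; $Aut(G)$ is the automorphism group as a permutation group on $V$. Permutation groups are considered up to permutation isomorphism. $GR(k)$ is the class of permutation groups $(A,V)$ with $A=Aut(G)$ for some $k$-colored graph $G$ on $V$. $C_n$ denotes the regular action of $\mathbb{Z}_n$ on $n$ points (the cyclic group of rotations of an $n$-cycle). For a permutation group $(A,V)$, the parallel product $A^{(r)}$ is $A$ acting on $V\times\{1,\ldots,r\}$ by $a((v,i))=(a(v),i)$. -}

module Defs where

open import Level using (0ℓ)
open import Data.Nat using (ℕ; zero; suc; _+_)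
open import Data.Nat.DivMod using (_mod_)
open import Data.Fin using (Fin; toℕ)
open import Data.Fin.Permutation using (Permutation′; _⟨$⟩ʳ_)
open import Data.Product using (Σ; ∃; _×_; _,_)
open import Function using (_∘_)
open import Function.Bundles using (_↔_; _⇔_; Inverse)
open import Relation.Binary.PropositionalEquality using (_≡_; _≢_)

-- A k-colored graph on the finite vertex set Fin m: a colouring of
-- unordered pairs, represented as a symmetric function Fin m → Fin m → Fin k
-- (values on the diagonal are irrelevant: they are never consulted).
record ColoredGraph (k m : ℕ) : Set where
  field
    col : Fin m → Fin m → Fin k
    sym : ∀ u v → col u v ≡ col v u
open ColoredGraph public

IsAut : ∀ {k m} → ColoredGraph k m → Permutation′ m → Set
IsAut G σ = ∀ u v → u ≢ v → col G (σ ⟨$⟩ʳ u) (σ ⟨$⟩ʳ v) ≡ col G u v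

PermGroupPred : Set → Set₁
PermGroupPred W = (W → W) → Set

-- (A , W) ∈ GR(k): there is a k-colored graph G on a finite set V (= Fin m)
-- and a bijection φ : V ↔ W (permutation isomorphism) such that
-- φ Aut(G) φ⁻¹ = A, i.e. a permutation σ of V is an automorphism of G
-- iff its conjugate φ ∘ σ ∘ φ⁻¹ lies in A.
GR : (k : ℕ) → (W : Set) → PermGroupPred W → Set
GR k W A =
  Σ ℕ λ m → Σ (ColoredGraph k m) λ G → Σ (Fin m ↔ W) λ φ →
    ∀ (σ : Permutation′ m) →
      IsAut G σ ⇔ A (Inverse.to φ ∘ (σ ⟨$⟩ʳ_) ∘ Inverse.from φ)

rot : (n : ℕ) → Fin n → Fin n → Fin n
rot zero    a v = v
rot (suc n) a v = (toℕ v + toℕ a) mod (suc n)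

Cn : (n : ℕ) → PermGroupPred (Fin n)
Cn n f = ∃ λ (a : Fin n) → ∀ x → f x ≡ rot n a x

parallel : ∀ {W : Set} → PermGroupPred W → (r : ℕ) → PermGroupPred (W × Fin r)
parallel {W} A r f =
  Σ (W → W) λ a → A a × (∀ v i → f (v , i) ≡ (a v , i))

-- Write s for the rotation u ↦ u + 1 of Z_n.  On the vertex set Z_n × {0,1}
-- we colour the unordered pairs with three colours:
--   * inside layer 0 every pair has colour 1, inside layer 1 colour 0;
--   * between (u,0) and (v,1): colour 2 if v = u, colour 1 if v = s u,
--     colour 0 otherwise.
-- Every rotation acting on both layers preserves this colouring.
-- Conversely, let τ be a colour-preserving bijection.  A layer-1 vertex has
-- only one neighbour of colour 1, while a layer-0 vertex has at least two
-- (here n ≥ 3 is used), so τ keeps layer 0; the colour-2 matching then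
-- forces τ(u,1) = (τ u,1), and the colour-1 edges (u,0)—(s u,1) give
-- τ(s u) = s (τ u).  Hence τ is the rotation by τ(0) on both layers.
module Submission where

open import Defs hiding (sym)
open import Data.Nat using (ℕ; zero; suc; _+_; _∸_; _%_; _<_; _≤_; s≤s; z≤n; NonZero)
open import Data.Nat.Properties
  using (+-assoc; +-comm; +-identityʳ; m+[n∸m]≡n; m≤n⇒m<n∨m≡n; <⇒≤; <⇒≢; 1+n≢n)
open import Data.Nat.DivMod
  using (_mod_; %-distribˡ-+; m%n%n≡m%n; [m+n]%n≡m%n; m<n⇒m%n≡m; n%n≡0; m%n<n)
open import Data.Fin using (Fin; toℕ; _≟_)
import Data.Fin as Fin
open import Data.Fin.Properties using (toℕ-injective; toℕ-fromℕ<; toℕ<n; *↔×)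
open import Data.Fin.Permutation using (Permutation′; _⟨$⟩ʳ_)
open import Data.Product using (_×_; _,_; ∃; proj₁; proj₂)
open import Data.Sum using (inj₁; inj₂)
open import Data.Bool using (if_then_else_)
open import Data.Empty using (⊥-elim)
open import Function using (_∘_)
open import Function.Bundles using (_↔_; _⇔_; Inverse; Injection; Equivalence; mk⇔)
open import Function.Definitions using (Injective)
open import Function.Properties.Inverse using (↔-sym; ↔-trans; ↔⇒↣)
open import Relation.Nullary using (yes; no)
open import Relation.Nullary.Decidable using (⌊_⌋)
open import Relation.Binary.PropositionalEquality

[m%n+k]%n≡[m+k]%n : ∀ m k n .{{_ : NonZero n}} → (m % n + k) % n ≡ (m + k) % n
[m%n+k]%n≡[m+k]%n m k n = begin
    (m % n + k) % n          ≡⟨ %-distribˡ-+ (m % n) k n ⟩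
    (m % n % n + k % n) % n  ≡⟨ cong (λ r → (r + k % n) % n) (m%n%n≡m%n m n) ⟩
    (m % n + k % n) % n      ≡⟨ %-distribˡ-+ m k n ⟨
    (m + k) % n              ∎
  where open ≡-Reasoning

≟-injective : ∀ {m n} (f : Fin m → Fin n) → Injective _≡_ _≡_ f →
              ∀ x y → ⌊ f x ≟ f y ⌋ ≡ ⌊ x ≟ y ⌋
≟-injective f f-inj x y with f x ≟ f y | x ≟ y
... | yes _     | yes _   = refl
... | no _      | no _    = refl
... | yes fx≡fy | no x≢y  = ⊥-elim (x≢y (f-inj fx≡fy))
... | no fx≢fy  | yes x≡y = ⊥-elim (fx≢fy (cong f x≡y))

-- Rotations of Z_N, realised on Fin N for N = suc n; 'shift (toℕ a)' is
-- definitionally the rotation 'rot N a' of the statement.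
module Rotation (n : ℕ) where

  N : ℕ
  N = suc n

  shift : ℕ → Fin N → Fin N
  shift j u = (toℕ u + j) mod N

  succ : Fin N → Fin N
  succ = shift 1

  toℕ-shift : ∀ j u → toℕ (shift j u) ≡ (toℕ u + j) % N
  toℕ-shift j u = toℕ-fromℕ< (m%n<n (toℕ u + j) N)

  shift-shift : ∀ i j u → shift i (shift j u) ≡ shift (j + i) u
  shift-shift i j u = toℕ-injective (begin
      toℕ (shift i (shift j u))   ≡⟨ toℕ-shift i (shift j u) ⟩
      (toℕ (shift j u) + i) % N   ≡⟨ cong (λ r → (r + i) % N) (toℕ-shift j u) ⟩
      ((toℕ u + j) % N + i) % N   ≡⟨ [m%n+k]%n≡[m+k]%n (toℕ u + j) i N ⟩
      (toℕ u + j + i) % N         ≡⟨ cong (_% N) (+-assoc (toℕ u) j i) ⟩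
      (toℕ u + (j + i)) % N       ≡⟨ toℕ-shift (j + i) u ⟨
      toℕ (shift (j + i) u)       ∎)
    where open ≡-Reasoning

  shift-comm : ∀ i j u → shift i (shift j u) ≡ shift j (shift i u)
  shift-comm i j u = begin
      shift i (shift j u)  ≡⟨ shift-shift i j u ⟩
      shift (j + i) u      ≡⟨ cong (λ l → shift l u) (+-comm j i) ⟩
      shift (i + j) u      ≡⟨ shift-shift j i u ⟨
      shift j (shift i u)  ∎
    where open ≡-Reasoning

  shift-0 : ∀ u → shift 0 u ≡ u
  shift-0 u = toℕ-injective (begin
      toℕ (shift 0 u)    ≡⟨ toℕ-shift 0 u ⟩
      (toℕ u + 0) % N    ≡⟨ cong (_% N) (+-identityʳ (toℕ u)) ⟩
      toℕ u % N          ≡⟨ m<n⇒m%n≡m (toℕ<n u) ⟩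
      toℕ u              ∎)
    where open ≡-Reasoning

  shift-N : ∀ u → shift N u ≡ u
  shift-N u = toℕ-injective (begin
      toℕ (shift N u)    ≡⟨ toℕ-shift N u ⟩
      (toℕ u + N) % N    ≡⟨ [m+n]%n≡m%n (toℕ u) N ⟩
      toℕ u % N          ≡⟨ m<n⇒m%n≡m (toℕ<n u) ⟩
      toℕ u              ∎)
    where open ≡-Reasoning

  shift-zero : ∀ (a : Fin N) → shift (toℕ a) Fin.zero ≡ a
  shift-zero a = toℕ-injective (trans (toℕ-shift (toℕ a) Fin.zero) (m<n⇒m%n≡m (toℕ<n a)))

  -- Shifting back by N ∸ j undoes a shift by j, so shifts are injective.
  shift-injective : ∀ {j} → j ≤ N → Injective _≡_ _≡_ (shift j)
  shift-injective {j} j≤N {u} {v} eq = begin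
      u                          ≡⟨ undo u ⟨
      shift (N ∸ j) (shift j u)  ≡⟨ cong (shift (N ∸ j)) eq ⟩
      shift (N ∸ j) (shift j v)  ≡⟨ undo v ⟩
      v                          ∎
    where
    open ≡-Reasoning
    undo : ∀ w → shift (N ∸ j) (shift j w) ≡ w
    undo w = trans (shift-shift (N ∸ j) j w)
                   (trans (cong (λ l → shift l w) (m+[n∸m]≡n j≤N)) (shift-N w))

  toℕ-succ : ∀ u → toℕ (succ u) ≡ suc (toℕ u) % N
  toℕ-succ u = trans (toℕ-shift 1 u) (cong (_% N) (+-comm (toℕ u) 1))

  succ-no-fixpoint : 1 < N → ∀ u → succ u ≢ u
  succ-no-fixpoint 1<N u su≡u with m≤n⇒m<n∨m≡n (toℕ<n u)
  ... | inj₁ 1+u<N = 1+n≢n (begin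
      suc (toℕ u)        ≡⟨ m<n⇒m%n≡m 1+u<N ⟨
      suc (toℕ u) % N    ≡⟨ toℕ-succ u ⟨
      toℕ (succ u)       ≡⟨ cong toℕ su≡u ⟩
      toℕ u              ∎)
    where open ≡-Reasoning
  ... | inj₂ 1+u≡N = <⇒≢ 1<N (begin
      1                  ≡⟨ cong suc u≡0 ⟨
      suc (toℕ u)        ≡⟨ 1+u≡N ⟩
      N                  ∎)
    where
    open ≡-Reasoning
    u≡0 : toℕ u ≡ 0
    u≡0 = begin
      toℕ u              ≡⟨ cong toℕ su≡u ⟨
      toℕ (succ u)       ≡⟨ toℕ-succ u ⟩
      suc (toℕ u) % N    ≡⟨ cong (_% N) 1+u≡N ⟩
      N % N              ≡⟨ n%n≡0 N ⟩
      0                  ∎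

  cyclic-induction : (P : Fin N → Set) → P Fin.zero → (∀ u → P u → P (succ u)) → ∀ u → P u
  cyclic-induction P P0 Psucc u = subst P (shift-zero u) (iterate (toℕ u))
    where
    iterate : ∀ m → P (shift m Fin.zero)
    iterate zero    = subst P (sym (shift-0 Fin.zero)) P0
    iterate (suc m) = subst P step (Psucc _ (iterate m))
      where
      step : succ (shift m Fin.zero) ≡ shift (suc m) Fin.zero
      step = trans (shift-shift 1 m Fin.zero) (cong (λ l → shift l Fin.zero) (+-comm m 1))

Preserves : ∀ {k} {W : Set} → (W → W → Fin k) → (W → W) → Set
Preserves c τ = ∀ x y → x ≢ y → c (τ x) (τ y) ≡ c x y

-- Transfer to GR(k): a symmetric k-colouring of a finite set W (enumerated
-- by φ) whose colour-preserving bijections are exactly the members of A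
-- exhibits A ∈ GR(k), via the pulled-back graph on Fin m.
GR-fromColouring : ∀ {k m} {W : Set} {A : PermGroupPred W} (φ : Fin m ↔ W)
  (c : W → W → Fin k) → (∀ x y → c x y ≡ c y x) →
  (∀ (π : W ↔ W) → Preserves c (Inverse.to π) ⇔ A (Inverse.to π)) → GR k W A
GR-fromColouring {k} {m} {W} φ c c-sym characterisation =
  m , G , φ , λ σ → mk⇔ (Equivalence.to (characterisation (conj σ)) ∘ aut⇒preserves σ)
                        (preserves⇒aut σ ∘ Equivalence.from (characterisation (conj σ)))
  where
  open Inverse φ using (to; from; strictlyInverseˡ; strictlyInverseʳ)

  G : ColoredGraph k m
  G = record { col = λ x y → c (to x) (to y) ; sym = λ x y → c-sym (to x) (to y) }

  conj : Permutation′ m → W ↔ W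
  conj σ = ↔-trans (↔-sym φ) (↔-trans σ φ)

  aut⇒preserves : ∀ σ → IsAut G σ → Preserves c (Inverse.to (conj σ))
  aut⇒preserves σ aut x y x≢y =
    subst₂ (λ x′ y′ → c (to (σ ⟨$⟩ʳ from x)) (to (σ ⟨$⟩ʳ from y)) ≡ c x′ y′)
           (strictlyInverseˡ x) (strictlyInverseˡ y)
           (aut (from x) (from y) (x≢y ∘ Injection.injective (↔⇒↣ (↔-sym φ))))

  preserves⇒aut : ∀ σ → Preserves c (Inverse.to (conj σ)) → IsAut G σ
  preserves⇒aut σ pres u v u≢v =
    subst₂ (λ u′ v′ → c (to (σ ⟨$⟩ʳ u′)) (to (σ ⟨$⟩ʳ v′)) ≡ c (to u) (to v))
           (strictlyInverseʳ u) (strictlyInverseʳ v)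
           (pres (to u) (to v) (u≢v ∘ Injection.injective (↔⇒↣ φ)))

module TwoLayer (k : ℕ) where
  open Rotation (suc (suc k)) public

  pattern L0 = Fin.zero
  pattern L1 = Fin.suc Fin.zero

  pattern c₀ = Fin.zero
  pattern c₁ = Fin.suc Fin.zero
  pattern c₂ = Fin.suc (Fin.suc Fin.zero)

  Vertex : Set
  Vertex = Fin N × Fin 2

  cross : Fin N → Fin N → Fin 3
  cross u v = if ⌊ u ≟ v ⌋ then c₂ else if ⌊ v ≟ succ u ⌋ then c₁ else c₀

  colour : Vertex → Vertex → Fin 3
  colour (u , L0) (v , L0) = c₁
  colour (u , L0) (v , L1) = cross u v
  colour (u , L1) (v , L0) = cross v u
  colour (u , L1) (v , L1) = c₀

  colour-sym : ∀ x y → colour x y ≡ colour y x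
  colour-sym (u , L0) (v , L0) = refl
  colour-sym (u , L0) (v , L1) = refl
  colour-sym (u , L1) (v , L0) = refl
  colour-sym (u , L1) (v , L1) = refl

  cross-matching : ∀ u → cross u u ≡ c₂
  cross-matching u with u ≟ u
  ... | yes _  = refl
  ... | no u≢u = ⊥-elim (u≢u refl)

  cross-successor : ∀ u → cross u (succ u) ≡ c₁
  cross-successor u with u ≟ succ u
  ... | yes u≡su = ⊥-elim (succ-no-fixpoint (s≤s (s≤s z≤n)) u (sym u≡su))
  ... | no _ with succ u ≟ succ u
  ...   | yes _    = refl
  ...   | no su≢su = ⊥-elim (su≢su refl)

  cross-c₂ : ∀ u v → cross u v ≡ c₂ → u ≡ v
  cross-c₂ u v h with u ≟ v
  ... | yes u≡v = u≡v
  ... | no _ with v ≟ succ u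
  cross-c₂ u v () | no _ | yes _
  cross-c₂ u v () | no _ | no _

  cross-c₁ : ∀ u v → cross u v ≡ c₁ → v ≡ succ u
  cross-c₁ u v h with u ≟ v
  cross-c₁ u v () | yes _
  ... | no _ with v ≟ succ u
  ...   | yes v≡su = v≡su
  cross-c₁ u v () | no _ | no _

  layer1-c₁-neighbour : ∀ v y → colour (v , L1) y ≡ c₁ → ∃ λ p → y ≡ (p , L0) × v ≡ succ p
  layer1-c₁-neighbour v (p , L0) h = p , refl , cross-c₁ p v h
  layer1-c₁-neighbour v (p , L1) ()

  layer0-c₂-neighbour : ∀ u y → colour (u , L0) y ≡ c₂ → y ≡ (u , L1)
  layer0-c₂-neighbour u (v , L0) ()
  layer0-c₂-neighbour u (v , L1) h = cong (_, L1) (sym (cross-c₂ u v h))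

  two-others : ∀ (u : Fin N) → ∃ λ w → ∃ λ w′ → w ≢ w′ × w ≢ u × w′ ≢ u
  two-others Fin.zero              = Fin.suc Fin.zero , Fin.suc (Fin.suc Fin.zero) , (λ ()) , (λ ()) , (λ ())
  two-others (Fin.suc Fin.zero)    = Fin.zero , Fin.suc (Fin.suc Fin.zero) , (λ ()) , (λ ()) , (λ ())
  two-others (Fin.suc (Fin.suc _)) = Fin.zero , Fin.suc Fin.zero , (λ ()) , (λ ()) , (λ ())

  succ-injective : Injective _≡_ _≡_ succ
  succ-injective = shift-injective (s≤s z≤n)

  cross-rotation : ∀ (a : Fin N) u v → cross (shift (toℕ a) u) (shift (toℕ a) v) ≡ cross u v
  cross-rotation a u v = cong₂ (λ b b′ → if b then c₂ else if b′ then c₁ else c₀)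
      (≟-injective ρ ρ-injective u v)
      (trans (cong (λ w → ⌊ ρ v ≟ w ⌋) (shift-comm 1 (toℕ a) u)) (≟-injective ρ ρ-injective v (succ u)))
    where
    ρ : Fin N → Fin N
    ρ = shift (toℕ a)
    ρ-injective : Injective _≡_ _≡_ ρ
    ρ-injective = shift-injective (<⇒≤ (toℕ<n a))

  colour-rotation : ∀ (a : Fin N) u i v j →
                    colour (shift (toℕ a) u , i) (shift (toℕ a) v , j) ≡ colour (u , i) (v , j)
  colour-rotation a u L0 v L0 = refl
  colour-rotation a u L0 v L1 = cross-rotation a u v
  colour-rotation a u L1 v L0 = cross-rotation a v u
  colour-rotation a u L1 v L1 = refl

  parallel⇒preserves : ∀ τ → parallel (Cn N) 2 τ → Preserves colour τ
  parallel⇒preserves τ (f , (a , f≡rot) , τ≡f) (u , i) (v , j) _ = begin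
      colour (τ (u , i)) (τ (v , j))                       ≡⟨ cong₂ colour (on-layer u i) (on-layer v j) ⟩
      colour (shift (toℕ a) u , i) (shift (toℕ a) v , j)   ≡⟨ colour-rotation a u i v j ⟩
      colour (u , i) (v , j)                               ∎
    where
    open ≡-Reasoning
    on-layer : ∀ w l → τ (w , l) ≡ (shift (toℕ a) w , l)
    on-layer w l = trans (τ≡f w l) (cong (_, l) (f≡rot w))

  module ColourPreserving (τ : Vertex → Vertex) (τ-injective : Injective _≡_ _≡_ τ)
                          (preserves : Preserves colour τ) where
    open ≡-Reasoning

    -- If (u,0) went to layer 1, every other (w,0) — a colour-1 neighbour of
    -- (u,0) — would go to the unique colour-1 neighbour of τ(u,0).
    forced-predecessor : ∀ {u w v} → τ (u , L0) ≡ (v , L1) → w ≢ u →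
                         ∃ λ p → τ (w , L0) ≡ (p , L0) × v ≡ succ p
    forced-predecessor {u} {w} {v} τu≡v w≢u = layer1-c₁-neighbour v (τ (w , L0)) (begin
        colour (v , L1) (τ (w , L0))       ≡⟨ cong (λ x → colour x (τ (w , L0))) τu≡v ⟨
        colour (τ (u , L0)) (τ (w , L0))   ≡⟨ preserves (u , L0) (w , L0) (w≢u ∘ sym ∘ cong proj₁) ⟩
        c₁                                 ∎)

    -- Two different points w, w′ cannot both be sent there, so layer 0 is kept.
    layer0-not-to-layer1 : ∀ u v → τ (u , L0) ≢ (v , L1)
    layer0-not-to-layer1 u v τu≡v with two-others u
    ... | w , w′ , w≢w′ , w≢u , w′≢u with forced-predecessor τu≡v w≢u | forced-predecessor τu≡v w′≢u
    ...   | p , τw≡p , v≡sp | p′ , τw′≡p′ , v≡sp′ = w≢w′ (cong proj₁ (τ-injective (begin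
        τ (w , L0)    ≡⟨ τw≡p ⟩
        (p , L0)      ≡⟨ cong (_, L0) (succ-injective (trans (sym v≡sp) v≡sp′)) ⟩
        (p′ , L0)     ≡⟨ τw′≡p′ ⟨
        τ (w′ , L0)   ∎)))

    image : Fin N → Fin N
    image u = proj₁ (τ (u , L0))

    layer0-image : ∀ u → τ (u , L0) ≡ (image u , L0)
    layer0-image u = cong (image u ,_) stays
      where
      stays : proj₂ (τ (u , L0)) ≡ L0
      stays with τ (u , L0) in τu≡
      ... | v , L0 = refl
      ... | v , L1 = ⊥-elim (layer0-not-to-layer1 u v τu≡)

    -- The colour-2 matching carries the action over to layer 1.
    layer1-image : ∀ u → τ (u , L1) ≡ (image u , L1)
    layer1-image u = layer0-c₂-neighbour (image u) (τ (u , L1)) (begin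
        colour (image u , L0) (τ (u , L1))   ≡⟨ cong (λ x → colour x (τ (u , L1))) (layer0-image u) ⟨
        colour (τ (u , L0)) (τ (u , L1))     ≡⟨ preserves (u , L0) (u , L1) (λ ()) ⟩
        cross u u                            ≡⟨ cross-matching u ⟩
        c₂                                   ∎)

    -- The colour-1 successor edges make image commute with succ.
    image-succ : ∀ u → image (succ u) ≡ succ (image u)
    image-succ u = cross-c₁ (image u) (image (succ u)) (begin
        colour (image u , L0) (image (succ u) , L1)   ≡⟨ cong₂ colour (layer0-image u) (layer1-image (succ u)) ⟨
        colour (τ (u , L0)) (τ (succ u , L1))         ≡⟨ preserves (u , L0) (succ u , L1) (λ ()) ⟩
        cross u (succ u)                              ≡⟨ cross-successor u ⟩
        c₁                                            ∎)

    image-rotation : ∀ u → image u ≡ shift (toℕ (image Fin.zero)) u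
    image-rotation = cyclic-induction (λ u → image u ≡ ρ u) (sym (shift-zero a)) λ u ih → begin
        image (succ u)   ≡⟨ image-succ u ⟩
        succ (image u)   ≡⟨ cong succ ih ⟩
        succ (ρ u)       ≡⟨ shift-comm 1 (toℕ a) u ⟩
        ρ (succ u)       ∎
      where
      a : Fin N
      a = image Fin.zero
      ρ : Fin N → Fin N
      ρ = shift (toℕ a)

    is-parallel-rotation : parallel (Cn N) 2 τ
    is-parallel-rotation = image , (image Fin.zero , image-rotation) , λ where
      u L0 → layer0-image u
      u L1 → layer1-image u

  characterisation : ∀ (π : Vertex ↔ Vertex) →
                     Preserves colour (Inverse.to π) ⇔ parallel (Cn N) 2 (Inverse.to π)
  characterisation π = mk⇔
    (ColourPreserving.is-parallel-rotation (Inverse.to π) (Injection.injective (↔⇒↣ π)))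
    (parallel⇒preserves (Inverse.to π))

lemma3p3 : (n : ℕ) → 3 ≤ n → GR 3 (Fin n × Fin 2) (parallel (Cn n) 2)
lemma3p3 (suc (suc (suc k))) (s≤s (s≤s (s≤s _))) =
  GR-fromColouring *↔× colour colour-sym characterisation
  where open TwoLayer k
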